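{- There is an absolute constant $c>0$ such that for every integer $\Delta\geq 2$ there exist connected graphs $G$ of maximum degree $\Delta$ with arbitrarily large neighbor-locating chromatic number $k=\chi_{NL}(G)$ whose order $n$ satisfies $n \geq c\,\Delta\left(\frac{k}{\Delta-1} \right)^{\Delta+1}$, i.e. $n=\Omega\left(\Delta\left(\frac{k}{\Delta-1} \right)^{\Delta+1}\right)$.
   Context: All graphs are finite and simple. For a proper $k$-coloring $f$ of $G$ and a vertex $x$, let $N_f(x)=\{f(y): y \text{ adjacent to } x\}$. Two vertices $x,y$ are neighbor-distinguished if $f(x)\neq f(y)$ or $N_f(x)\neq N_f(y)$; $f$ is a neighbor-locating $k$-coloring if every two distinct vertices are neighbor-distinguished. The neighbor-locating chromatic number $\chi_{NL}(G)$ is the minimum $k$ for which $G$ admits a neighbor-locating $k$-coloring. -}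

module Defs where

open import Data.Nat using (ℕ; zero; suc; _+_; _<_; _≤_)
open import Data.Bool using (Bool; true; false; _∧_; if_then_else_)
open import Data.Fin using (Fin; _≟_)
open import Data.Fin.Subset using (Subset)
open import Data.List using (List; map; allFin)
open import Data.Nat.ListAction using (sum)
open import Data.Bool.ListAction using (any)
open import Data.Vec using (tabulate)
open import Data.Product using (Σ; _×_)
open import Data.Sum using (_⊎_)
open import Relation.Nullary using (¬_)
open import Relation.Nullary.Decidable using (⌊_⌋)
open import Relation.Binary.PropositionalEquality using (_≡_; _≢_)

record Graph (n : ℕ) : Set where
  field
    adj    : Fin n → Fin n → Bool
    adj-sym : ∀ x y → adj x y ≡ adj y x
    adj-irr : ∀ x → adj x x ≡ false
open Graph public

deg : ∀ {n} → Graph n → Fin n → ℕ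
deg {n} G x = sum (map (λ y → if adj G x y then 1 else 0) (allFin n))

MaxDegree : ∀ {n} → Graph n → ℕ → Set
MaxDegree {n} G Δ = (∀ x → deg G x ≤ Δ) × Σ (Fin n) (λ x → deg G x ≡ Δ)

data Reach {n} (G : Graph n) : Fin n → Fin n → Set where
  here : ∀ {x} → Reach G x x
  step : ∀ {x y z} → adj G x y ≡ true → Reach G y z → Reach G x z

Connected : ∀ {n} → Graph n → Set
Connected {n} G = ∀ (x y : Fin n) → Reach G x y

Proper : ∀ {n k} → Graph n → (Fin n → Fin k) → Set
Proper G f = ∀ x y → adj G x y ≡ true → f x ≢ f y

Nf : ∀ {n k} → Graph n → (Fin n → Fin k) → Fin n → Subset k
Nf {n} G f x = tabulate (λ c → any (λ y → adj G x y ∧ ⌊ f y ≟ c ⌋) (allFin n))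

NeighborDistinguished : ∀ {n k} → Graph n → (Fin n → Fin k) → Fin n → Fin n → Set
NeighborDistinguished G f x y = f x ≢ f y ⊎ Nf G f x ≢ Nf G f y

IsNLColoring : ∀ {n k} → Graph n → (Fin n → Fin k) → Set
IsNLColoring {n} G f = Proper G f × (∀ (x y : Fin n) → x ≢ y → NeighborDistinguished G f x y)

HasNLColoring : ∀ {n} → Graph n → ℕ → Set
HasNLColoring {n} G k = Σ (Fin n → Fin k) (λ f → IsNLColoring G f)

χNL≡ : ∀ {n} → Graph n → ℕ → Set
χNL≡ G k = HasNLColoring G k × (∀ j → j < k → ¬ HasNLColoring G j)

-- Take D = Δ + 1 classes, each a copy of the cube [m]^D.  Join (i, x) to exactly one vertex
-- (j, σᵢⱼ x) of every other class j, where σᵢⱼ is a bijection fixing the coordinates i and j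
-- and σⱼᵢ = σᵢⱼ⁻¹.  The graph is Δ-regular on n = D·m^D vertices.  Coloring (i, x) by (i, xᵢ)
-- is proper, and the colors around (i, x) reveal every other coordinate of x, so this is a
-- neighbor-locating coloring with D·m colors.  All σᵢⱼ are the identity except on the
-- triangle of classes 0, 1, 2, where they are chosen so that the walk 0 → 1 → 2 → 0 advances
-- an odometer through all of [m]^D; this makes the graph connected.  Since a graph with a
-- neighbor-locating k-coloring has at most k·2^k vertices, m > K·2^K forces χ_NL ≥ K, while
-- χ_NL ≤ D·m gives Δ·χ_NL^D ≤ Δ·D^D·m^D ≤ 32·n·(Δ − 1)^D, because (1 + 1/t)^(t+1) ≤ 4.
module Submission where

open import Defs
open import Data.Nat as ℕ using (ℕ; zero; suc; _+_; _*_; _∸_; _^_; _≤_; _<_; z≤n; s≤s; pred)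
open import Data.Nat.Properties hiding (_≟_)
open import Data.Nat.Induction using (<-rec)
open import Data.Nat.Tactic.RingSolver using (solve-∀)
open import Data.Nat.ListAction using (sum)
open import Algebra.Properties.CommutativeMonoid.Sum +-0-commutativeMonoid
  using (sum-cong-≗; sum-replicate-zero) renaming (sum to ∑)
open import Data.Fin
  using (Fin; zero; suc; _≟_; toℕ; fromℕ; inject₁; lower₁; _↑ˡ_; _↑ʳ_; combine; remQuot; finToFun; funToFin)
open import Data.Fin.Patterns using (0F; 1F; 2F)
open import Data.Fin.Properties
  using (all?; any?; pigeonhole; 2↔Bool; combine-injective; combine-surjective; remQuot-combine;
         combine-remQuot; finToFun-funToFin; funToFin-finToFin; toℕ-injective; toℕ-fromℕ;
         toℕ-inject₁-≢; lower₁-inject₁′; inject₁-lower₁)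
import Data.Fin.Properties as Finₚ
open import Data.Fin.Induction using (<-weakInduction)
open import Data.Fin.Subset using (Subset)
open import Data.Bool as Bool using (Bool; true; false; _∧_; if_then_else_)
open import Data.Bool.Properties using (T-≡; T-∧)
open import Data.Bool.ListAction using (any; or)
open import Data.List as List using (allFin)
import Data.List.Properties as List
open import Data.List.Relation.Unary.Any using (satisfied)
open import Data.List.Relation.Unary.Any.Properties using (any⁺; any⁻)
open import Data.List.Membership.Propositional using (lose)
open import Data.List.Membership.Propositional.Properties using (∈-allFin)
open import Data.Vec using (lookup; tabulate)
open import Data.Vec.Properties using (lookup∘tabulate; tabulate∘lookup; tabulate-cong; ≡-dec)
open import Data.Product using (Σ; ∃; ∃₂; _×_; _,_; proj₁; proj₂; uncurry)
open import Data.Sum using (inj₁; inj₂)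
open import Data.Empty using (⊥-elim)
open import Function using (id; _∘_; mk⇔; Equivalence; Inverse)
open import Relation.Nullary using (¬_; Dec; yes; no; does; ¬?; contradiction)
open import Relation.Nullary.Decidable
  using (⌊_⌋; toWitness; fromWitness; _×-dec_; _⊎-dec_; _→-dec_; map′; dec-true; dec-false; does-⇔)
open import Relation.Unary using (Decidable)
open import Relation.Binary.PropositionalEquality
open import Relation.Binary.PropositionalEquality.Properties using (subst-injective)

^-distribʳ-* : ∀ m n o → (m * n) ^ o ≡ m ^ o * n ^ o
^-distribʳ-* m n zero    = refl
^-distribʳ-* m n (suc o) = begin
  m * n * (m * n) ^ o      ≡⟨ cong (m * n *_) (^-distribʳ-* m n o) ⟩
  m * n * (m ^ o * n ^ o)  ≡⟨ [m*n]*[o*p]≡[m*o]*[n*p] m n (m ^ o) (n ^ o) ⟩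
  m * m ^ o * (n * n ^ o)  ∎
  where open ≡-Reasoning

v^[1+n]+[1+n]*v^n≤[1+v]^[1+n] : ∀ v n → v ^ suc n + suc n * v ^ n ≤ suc v ^ suc n
v^[1+n]+[1+n]*v^n≤[1+v]^[1+n] v zero    = ≤-reflexive (+-comm (v * 1) 1)
v^[1+n]+[1+n]*v^n≤[1+v]^[1+n] v (suc n) = begin
  v * (v * w) + suc (suc n) * (v * w)              ≤⟨ m≤m+n _ (suc n * w) ⟩
  v * (v * w) + suc (suc n) * (v * w) + suc n * w  ≡⟨ regroup v n w ⟩
  suc v * (v * w + suc n * w)                      ≤⟨ *-monoʳ-≤ (suc v) (v^[1+n]+[1+n]*v^n≤[1+v]^[1+n] v n) ⟩
  suc v * suc v ^ suc n                            ∎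
  where
  open ≤-Reasoning
  w = v ^ n
  regroup : ∀ v n w → v * (v * w) + suc (suc n) * (v * w) + suc n * w ≡ suc v * (v * w + suc n * w)
  regroup = solve-∀

-- ((t + 1) / t) ^ (t + 1) ≥ ((t + 2) / (t + 1)) ^ (t + 2), with the denominators cleared.
[1+1/t]^[1+t]-antitone : ∀ t → suc (suc t) ^ suc (suc t) * t ^ suc t ≤ suc t ^ suc (suc t) * suc t ^ suc t
[1+1/t]^[1+t]-antitone t = begin
  suc (suc t) ^ suc (suc t) * t ^ suc t     ≡⟨ *-assoc (suc (suc t)) (suc (suc t) ^ suc t) (t ^ suc t) ⟩
  suc (suc t) * (suc (suc t) ^ suc t * t ^ suc t)
    ≡⟨ cong (suc (suc t) *_) (sym (^-distribʳ-* (suc (suc t)) t (suc t))) ⟩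
  suc (suc t) * (suc (suc t) * t) ^ suc t   ≡⟨ cong (λ z → suc (suc t) * z ^ suc t) (*-comm (suc (suc t)) t) ⟩
  suc (suc t) * v ^ suc t                   ≡⟨ +-comm (v ^ suc t) (suc t * v ^ suc t) ⟩
  suc t * v ^ suc t + v ^ suc t             ≤⟨ +-monoʳ-≤ (suc t * v ^ suc t) (m≤m+n (v ^ suc t) (v ^ t)) ⟩
  suc t * v ^ suc t + (v ^ suc t + v ^ t)   ≡⟨ regroup t (v ^ t) ⟩
  suc t * (v ^ suc t + suc t * v ^ t)       ≤⟨ *-monoʳ-≤ (suc t) (v^[1+n]+[1+n]*v^n≤[1+v]^[1+n] v t) ⟩
  suc t * suc v ^ suc t                     ≡⟨ cong (λ z → suc t * z ^ suc t) (suc-v t) ⟩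
  suc t * (suc t * suc t) ^ suc t           ≡⟨ cong (suc t *_) (^-distribʳ-* (suc t) (suc t) (suc t)) ⟩
  suc t * (suc t ^ suc t * suc t ^ suc t)   ≡⟨ *-assoc (suc t) (suc t ^ suc t) (suc t ^ suc t) ⟨
  suc t ^ suc (suc t) * suc t ^ suc t       ∎
  where
  open ≤-Reasoning
  v = t * suc (suc t)
  regroup : ∀ t y → suc t * (t * suc (suc t) * y) + (t * suc (suc t) * y + y)
                  ≡ suc t * (t * suc (suc t) * y + suc t * y)
  regroup = solve-∀
  suc-v : ∀ t → suc (t * suc (suc t)) ≡ suc t * suc t
  suc-v = solve-∀

[2+t]^[2+t]≤4*[1+t]^[2+t] : ∀ t → suc (suc t) ^ suc (suc t) ≤ 4 * suc t ^ suc (suc t)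
[2+t]^[2+t]≤4*[1+t]^[2+t] zero    = ≤-refl
[2+t]^[2+t]≤4*[1+t]^[2+t] (suc s) = *-cancelʳ-≤ _ _ (t ^ suc t) {{m^n≢0 t (suc t)}} (begin
  suc (suc t) ^ suc (suc t) * t ^ suc t   ≤⟨ [1+1/t]^[1+t]-antitone t ⟩
  suc t ^ suc (suc t) * suc t ^ suc t     ≤⟨ *-monoʳ-≤ (suc t ^ suc (suc t)) ([2+t]^[2+t]≤4*[1+t]^[2+t] s) ⟩
  suc t ^ suc (suc t) * (4 * t ^ suc t)   ≡⟨ *-assoc (suc t ^ suc (suc t)) 4 (t ^ suc t) ⟨
  suc t ^ suc (suc t) * 4 * t ^ suc t     ≡⟨ cong (_* t ^ suc t) (*-comm (suc t ^ suc (suc t)) 4) ⟩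
  4 * suc t ^ suc (suc t) * t ^ suc t     ∎)
  where
  open ≤-Reasoning
  t = suc s

Δ*[1+Δ]^[1+Δ]≤32*[1+Δ]*[Δ∸1]^[1+Δ] : ∀ Δ → 2 ≤ Δ → Δ * suc Δ ^ suc Δ ≤ 32 * suc Δ * (Δ ∸ 1) ^ suc Δ
Δ*[1+Δ]^[1+Δ]≤32*[1+Δ]*[Δ∸1]^[1+Δ] (suc (suc s)) (s≤s (s≤s z≤n)) = begin
  suc t * suc (suc t) ^ suc (suc t)            ≤⟨ *-monoʳ-≤ (suc t) ([2+t]^[2+t]≤4*[1+t]^[2+t] t) ⟩
  suc t * (4 * suc t ^ suc (suc t))            ≡⟨ regroup (suc t) (suc t ^ suc t) ⟩
  4 * (suc t * suc t) * suc t ^ suc t          ≤⟨ *-monoʳ-≤ (4 * (suc t * suc t)) ([2+t]^[2+t]≤4*[1+t]^[2+t] s) ⟩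
  4 * (suc t * suc t) * (4 * t ^ suc t)        ≤⟨ *-monoˡ-≤ (4 * t ^ suc t) (*-monoʳ-≤ 4 (square-bound s)) ⟩
  4 * (2 * t * suc (suc t)) * (4 * t ^ suc t)  ≡⟨ collect t (suc (suc t)) (t ^ suc t) ⟩
  32 * suc (suc t) * (t * t ^ suc t)           ∎
  where
  open ≤-Reasoning
  t = suc s
  regroup : ∀ a b → a * (4 * (a * b)) ≡ 4 * (a * a) * b
  regroup = solve-∀
  square-bound : ∀ s → suc (suc s) * suc (suc s) ≤ 2 * suc s * suc (suc (suc s))
  square-bound s = ≤-trans (m≤n+m _ (s * s + 4 * s + 2)) (≤-reflexive (expand s))
    where
    expand : ∀ s → s * s + 4 * s + 2 + suc (suc s) * suc (suc s) ≡ 2 * suc s * suc (suc (suc s))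
    expand = solve-∀
  collect : ∀ t u x → 4 * (2 * t * u) * (4 * x) ≡ 32 * u * (t * x)
  collect = solve-∀

Δ*k^[1+Δ]≤32*[1+Δ]*m^[1+Δ]*[Δ∸1]^[1+Δ] : ∀ Δ {k m} → 2 ≤ Δ → k ≤ suc Δ * m →
  Δ * k ^ suc Δ ≤ 32 * (suc Δ * m ^ suc Δ) * (Δ ∸ 1) ^ suc Δ
Δ*k^[1+Δ]≤32*[1+Δ]*m^[1+Δ]*[Δ∸1]^[1+Δ] Δ {k} {m} 2≤Δ k≤[1+Δ]*m = begin
  Δ * k ^ suc Δ                               ≤⟨ *-monoʳ-≤ Δ (^-monoˡ-≤ (suc Δ) k≤[1+Δ]*m) ⟩
  Δ * (suc Δ * m) ^ suc Δ                     ≡⟨ cong (Δ *_) (^-distribʳ-* (suc Δ) m (suc Δ)) ⟩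
  Δ * (suc Δ ^ suc Δ * m ^ suc Δ)             ≡⟨ *-assoc Δ _ _ ⟨
  Δ * suc Δ ^ suc Δ * m ^ suc Δ               ≤⟨ *-monoˡ-≤ (m ^ suc Δ) (Δ*[1+Δ]^[1+Δ]≤32*[1+Δ]*[Δ∸1]^[1+Δ] Δ 2≤Δ) ⟩
  32 * suc Δ * (Δ ∸ 1) ^ suc Δ * m ^ suc Δ    ≡⟨ regroup 32 (suc Δ) ((Δ ∸ 1) ^ suc Δ) (m ^ suc Δ) ⟩
  32 * (suc Δ * m ^ suc Δ) * (Δ ∸ 1) ^ suc Δ  ∎
  where
  open ≤-Reasoning
  regroup : ∀ a b x y → a * b * x * y ≡ a * (b * y) * x
  regroup = solve-∀

sum-tabulate : ∀ n (h : Fin n → ℕ) → sum (List.tabulate h) ≡ ∑ h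
sum-tabulate zero    h = refl
sum-tabulate (suc n) h = cong (h zero +_) (sum-tabulate n (h ∘ suc))

sum-map-allFin : ∀ n (h : Fin n → ℕ) → sum (List.map h (allFin n)) ≡ ∑ h
sum-map-allFin n h = trans (cong sum (List.map-tabulate id h)) (sum-tabulate n h)

∑-↑ : ∀ a b (h : Fin (a + b) → ℕ) → ∑ h ≡ ∑ (h ∘ (_↑ˡ b)) + ∑ (h ∘ (a ↑ʳ_))
∑-↑ zero    b h = refl
∑-↑ (suc a) b h = trans (cong (h zero +_) (∑-↑ a b (h ∘ suc))) (sym (+-assoc (h zero) _ _))

∑-combine : ∀ a b (h : Fin (a * b) → ℕ) → ∑ h ≡ ∑ {a} λ i → ∑ {b} λ j → h (combine i j)
∑-combine zero    b h = refl
∑-combine (suc a) b h =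
  trans (∑-↑ b (a * b) h) (cong (∑ (h ∘ (_↑ˡ a * b)) +_) (∑-combine a b (h ∘ (b ↑ʳ_))))

∑-const-1 : ∀ n → ∑ {n} (λ _ → 1) ≡ n
∑-const-1 zero    = refl
∑-const-1 (suc n) = cong suc (∑-const-1 n)

∑-indicator-≡ : ∀ {n} (c : Fin n) → ∑ (λ r → if does (r ≟ c) then 1 else 0) ≡ 1
∑-indicator-≡ {suc n} zero    = cong suc (sum-replicate-zero n)
∑-indicator-≡         (suc c) = ∑-indicator-≡ c

∑-indicator-≢ : ∀ {n} (i : Fin (suc n)) → ∑ (λ j → if does (i ≟ j) then 0 else 1) ≡ n
∑-indicator-≢ {n}     zero    = ∑-const-1 n
∑-indicator-≢ {suc n} (suc i) = cong suc (∑-indicator-≢ i)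

funToFin-cong : ∀ {m n} {f g : Fin m → Fin n} → (∀ i → f i ≡ g i) → funToFin f ≡ funToFin g
funToFin-cong {zero}  f≗g = refl
funToFin-cong {suc m} f≗g = cong₂ combine (f≗g zero) (funToFin-cong (f≗g ∘ suc))

finToFun-injective : ∀ {m n} {i j : Fin (m ^ n)} → (∀ k → finToFun {m} {n} i k ≡ finToFun j k) → i ≡ j
finToFun-injective {m} {n} {i} {j} finToFun≗ = begin
  i                             ≡⟨ funToFin-finToFin {n} {m} i ⟨
  funToFin (finToFun {m} {n} i) ≡⟨ funToFin-cong finToFun≗ ⟩
  funToFin (finToFun {m} {n} j) ≡⟨ funToFin-finToFin {n} {m} j ⟩
  j                             ∎
  where open ≡-Reasoning

funToFin-injective : ∀ {m n} {f g : Fin m → Fin n} → funToFin f ≡ funToFin g → ∀ i → f i ≡ g i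
funToFin-injective {f = f} {g} funToFin≡ i = begin
  f i                      ≡⟨ finToFun-funToFin f i ⟨
  finToFun (funToFin f) i  ≡⟨ cong (λ k → finToFun k i) funToFin≡ ⟩
  finToFun (funToFin g) i  ≡⟨ finToFun-funToFin g i ⟩
  g i                      ∎
  where open ≡-Reasoning

subsetCode : ∀ {k} → Subset k → Fin (2 ^ k)
subsetCode v = funToFin (Inverse.from 2↔Bool ∘ lookup v)

subsetCode-injective : ∀ {k} (v w : Subset k) → subsetCode v ≡ subsetCode w → v ≡ w
subsetCode-injective v w code≡ = begin
  v                    ≡⟨ tabulate∘lookup v ⟨
  tabulate (lookup v)  ≡⟨ tabulate-cong lookup≗ ⟩
  tabulate (lookup w)  ≡⟨ tabulate∘lookup w ⟩
  w                    ∎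
  where
  open ≡-Reasoning
  open Inverse 2↔Bool using (to; from; strictlyInverseˡ)
  lookup≗ : ∀ c → lookup v c ≡ lookup w c
  lookup≗ c = begin
    lookup v c              ≡⟨ strictlyInverseˡ (lookup v c) ⟨
    to (from (lookup v c))  ≡⟨ cong to (funToFin-injective code≡ c) ⟩
    to (from (lookup w c))  ≡⟨ strictlyInverseˡ (lookup w c) ⟩
    lookup w c              ∎

module _ {n} (G : Graph n) where

  Reach-trans : ∀ {x y z} → Reach G x y → Reach G y z → Reach G x z
  Reach-trans here       q = q
  Reach-trans (step e p) q = step e (Reach-trans p q)

  Reach-sym : ∀ {x y} → Reach G x y → Reach G y x
  Reach-sym here = here
  Reach-sym {x} (step {y = y} e p) = Reach-trans (Reach-sym p) (step (trans (adj-sym G y x) e) here)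

module _ {n k} (G : Graph n) (f : Fin n → Fin k) where

  Nf-lookup : ∀ x c → lookup (Nf G f x) c ≡ any (λ y → adj G x y ∧ ⌊ f y ≟ c ⌋) (allFin n)
  Nf-lookup x = lookup∘tabulate (λ c → any (λ y → adj G x y ∧ ⌊ f y ≟ c ⌋) (allFin n))

  ∈Nf⁺ : ∀ {x y} → adj G x y ≡ true → lookup (Nf G f x) (f y) ≡ true
  ∈Nf⁺ {x} {y} xy = trans (Nf-lookup x (f y)) (Equivalence.to T-≡
    (any⁺ _ (lose (∈-allFin y) (Equivalence.from T-∧ (Equivalence.from T-≡ xy , fromWitness refl)))))

  ∈Nf⁻ : ∀ {x c} → lookup (Nf G f x) c ≡ true → ∃ λ y → adj G x y ≡ true × f y ≡ c
  ∈Nf⁻ {x} {c} c∈Nf =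
    let y , xy∧fy≡c = satisfied (any⁻ _ (allFin n) (Equivalence.from T-≡ (trans (sym (Nf-lookup x c)) c∈Nf)))
        xy , fy≡c   = Equivalence.to T-∧ xy∧fy≡c
    in y , Equivalence.to T-≡ xy , toWitness fy≡c

  Nf-cong : ∀ {g : Fin n → Fin k} → (∀ x → f x ≡ g x) → ∀ x → Nf G f x ≡ Nf G g x
  Nf-cong f≗g x = tabulate-cong λ c →
    cong or (List.map-cong (λ y → cong (λ z → adj G x y ∧ ⌊ z ≟ c ⌋) (f≗g y)) (allFin n))

  isNLColoring? : Dec (IsNLColoring G f)
  isNLColoring? =
    (all? λ x → all? λ y → (adj G x y Bool.≟ true) →-dec ¬? (f x ≟ f y)) ×-dec
    (all? λ x → all? λ y → ¬? (x ≟ y) →-dec (¬? (f x ≟ f y) ⊎-dec ¬? (≡-dec Bool._≟_ (Nf G f x) (Nf G f y))))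

IsNLColoring-resp-≗ : ∀ {n k} (G : Graph n) {f g : Fin n → Fin k} →
                      (∀ x → f x ≡ g x) → IsNLColoring G f → IsNLColoring G g
IsNLColoring-resp-≗ G {f} {g} f≗g (proper , distinguished) = proper′ , distinguished′
  where
  transport-≢ : ∀ {x y} → f x ≢ f y → g x ≢ g y
  transport-≢ {x} {y} fx≢fy gx≡gy = fx≢fy (trans (f≗g x) (trans gx≡gy (sym (f≗g y))))
  proper′ : Proper G g
  proper′ x y xy = transport-≢ (proper x y xy)
  distinguished′ : ∀ x y → x ≢ y → NeighborDistinguished G g x y
  distinguished′ x y x≢y with distinguished x y x≢y
  ... | inj₁ fx≢fy = inj₁ (transport-≢ fx≢fy)
  ... | inj₂ Nx≢Ny = inj₂ λ Nx≡Ny →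
    Nx≢Ny (trans (Nf-cong G f f≗g x) (trans Nx≡Ny (sym (Nf-cong G f f≗g y))))

hasNLColoring? : ∀ {n} (G : Graph n) k → Dec (HasNLColoring G k)
hasNLColoring? G k = map′
  (λ (i , nl) → finToFun i , nl)
  (λ (f , nl) → funToFin f , IsNLColoring-resp-≗ G (λ x → sym (finToFun-funToFin f x)) nl)
  (any? λ i → isNLColoring? G (finToFun i))

least-witness : ∀ {P : ℕ → Set} → Decidable P → ∀ {b} → P b →
                ∃ λ k → k ≤ b × P k × (∀ j → j < k → ¬ P j)
least-witness {P} P? {b} = <-rec LeastBelow search b
  where
  LeastBelow : ℕ → Set
  LeastBelow b = P b → ∃ λ k → k ≤ b × P k × (∀ j → j < k → ¬ P j)
  search : ∀ b → (∀ {j} → j < b → LeastBelow j) → LeastBelow b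
  search b smaller pb with anyUpTo? P? b
  ... | yes (j , j<b , pj) = let k , k≤j , pk , least = smaller j<b pj
                             in k , ≤-trans k≤j (<⇒≤ j<b) , pk , least
  ... | no none            = b , ≤-refl , pb , λ j j<b pj → none (j , j<b , pj)

χNL-exists : ∀ {n} (G : Graph n) {k} → HasNLColoring G k → ∃ λ k₀ → k₀ ≤ k × χNL≡ G k₀
χNL-exists G has = let k₀ , k₀≤k , has₀ , least = least-witness (hasNLColoring? G) has
                   in k₀ , k₀≤k , has₀ , least

-- A vertex is determined by its color and the set of colors around it.
order≤k*2^k : ∀ {n} (G : Graph n) {k} → HasNLColoring G k → n ≤ k * 2 ^ k
order≤k*2^k {n} G {k} (f , _ , distinguished) with n ℕ.≤? k * 2 ^ k
... | yes n≤ = n≤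
... | no n≰ with pigeonhole (≰⇒> n≰) (λ x → combine (f x) (subsetCode (Nf G f x)))
... | x , y , x<y , code≡ with combine-injective (f x) _ (f y) _ code≡
... | fx≡fy , Nx≡Ny with distinguished x y (Finₚ.<⇒≢ x<y)
... | inj₁ fx≢fy = ⊥-elim (fx≢fy fx≡fy)
... | inj₂ Nx≢Ny = ⊥-elim (Nx≢Ny (subsetCode-injective _ _ Nx≡Ny))

-- Graphs glued from permutations between classes

module PermutationGraph {Δ N : ℕ} (π : Fin (suc Δ) → Fin (suc Δ) → Fin N → Fin N)
                        (π-inverse : ∀ i j r → π j i (π i j r) ≡ r) where

  Adjacent : Fin (suc Δ) × Fin N → Fin (suc Δ) × Fin N → Bool
  Adjacent (i , r) (j , r′) = if does (i ≟ j) then false else does (r′ ≟ π i j r)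

  Adjacent-sym : ∀ p q → Adjacent p q ≡ Adjacent q p
  Adjacent-sym (i , r) (j , r′) = cong₂ (λ b c → if b then false else c)
    (does-⇔ (mk⇔ sym sym) (i ≟ j) (j ≟ i))
    (does-⇔ (mk⇔ (flip i j) (flip j i)) (r′ ≟ π i j r) (r ≟ π j i r′))
    where
    flip : ∀ i j {r r′} → r′ ≡ π i j r → r ≡ π j i r′
    flip i j refl = sym (π-inverse i j _)

  Adjacent-irrefl : ∀ p → Adjacent p p ≡ false
  Adjacent-irrefl (i , r) = cong (λ b → if b then false else _) (dec-true (i ≟ i) refl)

  Adjacent⁺ : ∀ {i j} r → i ≢ j → Adjacent (i , r) (j , π i j r) ≡ true
  Adjacent⁺ {i} {j} r i≢j with i ≟ j
  ... | yes i≡j = contradiction i≡j i≢j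
  ... | no _    = dec-true (π i j r ≟ π i j r) refl

  Adjacent⁻ : ∀ {i r j r′} → Adjacent (i , r) (j , r′) ≡ true → i ≢ j × r′ ≡ π i j r
  Adjacent⁻ {i} {r} {j} {r′} _ with i ≟ j | r′ ≟ π i j r
  Adjacent⁻ () | yes _  | _
  Adjacent⁻ () | no _   | no _
  ...          | no i≢j | yes r′≡ = i≢j , r′≡

  vertex : Fin (suc Δ) → Fin N → Fin (suc Δ * N)
  vertex = combine

  vertex-surjective : ∀ u → ∃₂ λ i r → vertex i r ≡ u
  vertex-surjective = combine-surjective {suc Δ} {N}

  G : Graph (suc Δ * N)
  G = record
    { adj     = λ u v → Adjacent (remQuot N u) (remQuot N v)
    ; adj-sym = λ u v → Adjacent-sym (remQuot N u) (remQuot N v)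
    ; adj-irr = λ u → Adjacent-irrefl (remQuot N u)
    }

  adj-vertex : ∀ i r j r′ → adj G (vertex i r) (vertex j r′) ≡ Adjacent (i , r) (j , r′)
  adj-vertex i r j r′ = cong₂ Adjacent (remQuot-combine i r) (remQuot-combine j r′)

  adj-π : ∀ {i j} r → i ≢ j → adj G (vertex i r) (vertex j (π i j r)) ≡ true
  adj-π {i} {j} r i≢j = trans (adj-vertex i r j (π i j r)) (Adjacent⁺ r i≢j)

  private
    indicator : Bool → ℕ
    indicator b = if b then 1 else 0

  ∑-Adjacent : ∀ i r j → ∑ (λ r′ → indicator (Adjacent (i , r) (j , r′))) ≡ (if does (i ≟ j) then 0 else 1)
  ∑-Adjacent i r j with does (i ≟ j)
  ... | true  = sum-replicate-zero N
  ... | false = ∑-indicator-≡ (π i j r)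

  deg-vertex : ∀ i r → deg G (vertex i r) ≡ Δ
  deg-vertex i r = begin
    deg G (vertex i r)
      ≡⟨ sum-map-allFin (suc Δ * N) (λ v → indicator (adj G (vertex i r) v)) ⟩
    ∑ (λ v → indicator (adj G (vertex i r) v))
      ≡⟨ ∑-combine (suc Δ) N _ ⟩
    ∑ (λ j → ∑ λ r′ → indicator (adj G (vertex i r) (vertex j r′)))
      ≡⟨ sum-cong-≗ (λ j → sum-cong-≗ λ r′ → cong indicator (adj-vertex i r j r′)) ⟩
    ∑ (λ j → ∑ λ r′ → indicator (Adjacent (i , r) (j , r′)))
      ≡⟨ sum-cong-≗ (∑-Adjacent i r) ⟩
    ∑ (λ j → if does (i ≟ j) then 0 else 1)
      ≡⟨ ∑-indicator-≢ i ⟩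
    Δ ∎
    where open ≡-Reasoning

  deg-regular : ∀ u → deg G u ≡ Δ
  deg-regular u with vertex-surjective u
  ... | i , r , refl = deg-vertex i r

  module Coloring {m} (coord : Fin (suc Δ) → Fin N → Fin m)
                  (coord-π : ∀ i j r → coord j (π i j r) ≡ coord j r)
                  (coord-injective : ∀ {r r′} → (∀ j → coord j r ≡ coord j r′) → r ≡ r′) where

    color : Fin (suc Δ * N) → Fin (suc Δ * m)
    color u = uncurry (λ i r → combine i (coord i r)) (remQuot N u)

    color-vertex : ∀ i r → color (vertex i r) ≡ combine i (coord i r)
    color-vertex i r = cong (uncurry (λ i r → combine i (coord i r))) (remQuot-combine i r)

    color-π : ∀ i j r → color (vertex j (π i j r)) ≡ combine j (coord j r)
    color-π i j r = trans (color-vertex j (π i j r)) (cong (combine j) (coord-π i j r))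

    neighbor-color : ∀ {i r v} → adj G (vertex i r) v ≡ true → ∃ λ j → i ≢ j × color v ≡ combine j (coord j r)
    neighbor-color {i} {r} {v} iv with vertex-surjective v
    ... | j , r′ , refl with Adjacent⁻ {i} {r} {j} {r′} (trans (sym (adj-vertex i r j r′)) iv)
    ... | i≢j , refl = j , i≢j , color-π i j r

    color-proper : Proper G color
    color-proper u v uv with vertex-surjective u
    ... | i , r , refl with neighbor-color uv
    ... | j , i≢j , color-v = λ color≡ →
      i≢j (proj₁ (combine-injective i _ j _ (trans (sym (color-vertex i r)) (trans color≡ color-v))))

    -- The neighbor of (i, r) in class j has color (j, coord j r), so Nf recovers every coordinate but the i-th.
    color-Nf-injective : ∀ {u v} → color u ≡ color v → Nf G color u ≡ Nf G color v → u ≡ v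
    color-Nf-injective {u} {v} color≡ Nf≡ with vertex-surjective u | vertex-surjective v
    ... | i , r , refl | i′ , r′ , refl
        with combine-injective i _ i′ _ (trans (sym (color-vertex i r)) (trans color≡ (color-vertex i′ r′)))
    ... | refl , coord-i≡ = cong (vertex i) (coord-injective coord≡)
      where
      coord≡ : ∀ j → coord j r ≡ coord j r′
      coord≡ j with i ≟ j
      ... | yes refl = coord-i≡
      ... | no i≢j
          with ∈Nf⁻ G color (subst (λ N → lookup N (color (vertex j (π i j r))) ≡ true) Nf≡
                                   (∈Nf⁺ G color (adj-π r i≢j)))
      ... | y , r′y , color-y with neighbor-color {i} {r′} r′y
      ... | j′ , _ , color-y′ with combine-injective j′ _ j _ (trans (sym color-y′) (trans color-y (color-π i j r)))
      ... | refl , coord-j≡ = sym coord-j≡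

    color-isNLColoring : IsNLColoring G color
    color-isNLColoring = color-proper , distinguished
      where
      distinguished : ∀ u v → u ≢ v → NeighborDistinguished G color u v
      distinguished u v u≢v with color u ≟ color v
      ... | no color≢  = inj₁ color≢
      ... | yes color≡ = inj₂ λ Nf≡ → u≢v (color-Nf-injective color≡ Nf≡)

opaque
  isLast : ∀ {n} → Fin (suc n) → Bool
  isLast {n} i = does (n ℕ.≟ toℕ i)

  next : ∀ {n} → Fin (suc n) → Fin (suc n)
  next {n} i with n ℕ.≟ toℕ i
  ... | yes _  = zero
  ... | no n≢i = suc (lower₁ i n≢i)

  prev : ∀ {n} → Fin (suc n) → Fin (suc n)
  prev {n} zero    = fromℕ n
  prev     (suc j) = inject₁ j

  isLast-fromℕ : ∀ n → isLast (fromℕ n) ≡ true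
  isLast-fromℕ n = dec-true (n ℕ.≟ toℕ (fromℕ n)) (sym (toℕ-fromℕ n))

  isLast-inject₁ : ∀ {n} (j : Fin n) → isLast (inject₁ j) ≡ false
  isLast-inject₁ {n} j = dec-false (n ℕ.≟ toℕ (inject₁ j)) (toℕ-inject₁-≢ j)

  next-fromℕ : ∀ n → next (fromℕ n) ≡ zero
  next-fromℕ n with n ℕ.≟ toℕ (fromℕ n)
  ... | yes _  = refl
  ... | no n≢n = contradiction (sym (toℕ-fromℕ n)) n≢n

  next-inject₁ : ∀ {n} (j : Fin n) → next (inject₁ j) ≡ suc j
  next-inject₁ {n} j with n ℕ.≟ toℕ (inject₁ j)
  ... | yes n≡j = contradiction n≡j (toℕ-inject₁-≢ j)
  ... | no n≢j  = cong suc (lower₁-inject₁′ j n≢j)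

  prev-next : ∀ {n} (i : Fin (suc n)) → prev (next i) ≡ i
  prev-next {n} i with n ℕ.≟ toℕ i
  ... | yes n≡i = toℕ-injective (trans (toℕ-fromℕ n) n≡i)
  ... | no n≢i  = inject₁-lower₁ i n≢i

  next-prev : ∀ {n} (i : Fin (suc n)) → next (prev i) ≡ i
  next-prev {n} zero    = next-fromℕ n
  next-prev     (suc j) = next-inject₁ j

when : ∀ {A : Set} → Bool → (A → A) → A → A
when c f = if c then f else id

when-inverse : ∀ {A : Set} {f g : A → A} → (∀ x → g (f x) ≡ x) → ∀ c x → when c g (when c f x) ≡ x
when-inverse g∘f≗id true  x = g∘f≗id x
when-inverse g∘f≗id false x = refl

-- Here Δ = s + 2 and m = m′ + 1.  A state (a , b , w) of a class carries the coordinates 0 and 1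
-- as a and b; the remaining Δ - 1 coordinates are the digits of w.
module Odometer {s m′ c : ℕ} (digits : Fin (suc c) → Fin (suc s) → Fin (suc m′))
                (digits-injective : ∀ {w w′} → (∀ j → digits w j ≡ digits w′ j) → w ≡ w′) where

  m : ℕ
  m = suc m′

  D : ℕ
  D = suc (suc (suc s))

  State : Set
  State = Fin m × Fin m × Fin (suc c)

  N : ℕ
  N = m * (m * suc c)

  encode : State → Fin N
  encode (a , b , w) = combine a (combine b w)

  decode : Fin N → State
  decode r = let a , r′ = remQuot {m} (m * suc c) r in a , remQuot {m} (suc c) r′

  decode-encode : ∀ x → decode (encode x) ≡ x
  decode-encode (a , b , w) = begin
    decode (combine a (combine b w))   ≡⟨ cong (λ (a , r′) → a , remQuot (suc c) r′) (remQuot-combine a (combine b w)) ⟩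
    a , remQuot (suc c) (combine b w)  ≡⟨ cong (a ,_) (remQuot-combine b w) ⟩
    a , b , w                          ∎
    where open ≡-Reasoning

  encode-decode : ∀ r → encode (decode r) ≡ r
  encode-decode r = trans (cong (combine (proj₁ q)) (combine-remQuot {m} (suc c) (proj₂ q)))
                          (combine-remQuot {m} (m * suc c) r)
    where q = remQuot {m} (m * suc c) r

  σ : Fin D → Fin D → State → State
  σ 0F 1F (a , b , w) = a , b , when (isLast b ∧ isLast a) next w
  σ 1F 0F (a , b , w) = a , b , when (isLast b ∧ isLast a) prev w
  σ 1F 2F (a , b , w) = when (isLast b) next a , b , w
  σ 2F 1F (a , b , w) = when (isLast b) prev a , b , w
  σ 2F 0F (a , b , w) = a , next b , w
  σ 0F 2F (a , b , w) = a , prev b , w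
  σ _  _  x           = x

  σ-inverse : ∀ i j x → σ j i (σ i j x) ≡ x
  σ-inverse 0F 1F (a , b , w) = cong (λ w → a , b , w) (when-inverse prev-next (isLast b ∧ isLast a) w)
  σ-inverse 1F 0F (a , b , w) = cong (λ w → a , b , w) (when-inverse next-prev (isLast b ∧ isLast a) w)
  σ-inverse 1F 2F (a , b , w) = cong (λ a → a , b , w) (when-inverse prev-next (isLast b) a)
  σ-inverse 2F 1F (a , b , w) = cong (λ a → a , b , w) (when-inverse next-prev (isLast b) a)
  σ-inverse 2F 0F (a , b , w) = cong (λ b → a , b , w) (prev-next b)
  σ-inverse 0F 2F (a , b , w) = cong (λ b → a , b , w) (next-prev b)
  σ-inverse 0F 0F                   x = refl
  σ-inverse 1F 1F                   x = refl
  σ-inverse 2F 2F                   x = refl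
  σ-inverse 0F (suc (suc (suc _)))  x = refl
  σ-inverse 1F (suc (suc (suc _)))  x = refl
  σ-inverse 2F (suc (suc (suc _)))  x = refl
  σ-inverse (suc (suc (suc _))) 0F  x = refl
  σ-inverse (suc (suc (suc _))) 1F  x = refl
  σ-inverse (suc (suc (suc _))) 2F  x = refl
  σ-inverse (suc (suc (suc _))) (suc (suc (suc _))) x = refl

  coord : Fin D → State → Fin m
  coord 0F            (a , b , w) = a
  coord 1F            (a , b , w) = b
  coord (suc (suc j)) (a , b , w) = digits w j

  coord-σ : ∀ i j x → coord j (σ i j x) ≡ coord j x
  coord-σ 0F 1F (a , b , w) = refl
  coord-σ 1F 0F (a , b , w) = refl
  coord-σ 1F 2F (a , b , w) = refl
  coord-σ 2F 1F (a , b , w) = refl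
  coord-σ 2F 0F (a , b , w) = refl
  coord-σ 0F 2F (a , b , w) = refl
  coord-σ 0F 0F                   x = refl
  coord-σ 1F 1F                   x = refl
  coord-σ 2F 2F                   x = refl
  coord-σ 0F (suc (suc (suc _)))  x = refl
  coord-σ 1F (suc (suc (suc _)))  x = refl
  coord-σ 2F (suc (suc (suc _)))  x = refl
  coord-σ (suc (suc (suc _))) 0F  x = refl
  coord-σ (suc (suc (suc _))) 1F  x = refl
  coord-σ (suc (suc (suc _))) 2F  x = refl
  coord-σ (suc (suc (suc _))) (suc (suc (suc _))) x = refl

  coord-injective : ∀ {x x′} → (∀ j → coord j x ≡ coord j x′) → x ≡ x′
  coord-injective {a , b , w} {a′ , b′ , w′} coord≡ =
    cong₂ _,_ (coord≡ 0F) (cong₂ _,_ (coord≡ 1F) (digits-injective λ j → coord≡ (suc (suc j))))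

  π : Fin D → Fin D → Fin N → Fin N
  π i j = encode ∘ σ i j ∘ decode

  π-inverse : ∀ i j r → π j i (π i j r) ≡ r
  π-inverse i j r = begin
    encode (σ j i (decode (encode (σ i j (decode r)))))  ≡⟨ cong (encode ∘ σ j i) (decode-encode _) ⟩
    encode (σ j i (σ i j (decode r)))                    ≡⟨ cong encode (σ-inverse i j (decode r)) ⟩
    encode (decode r)                                    ≡⟨ encode-decode r ⟩
    r                                                    ∎
    where open ≡-Reasoning

  open PermutationGraph π π-inverse public

  open Coloring (λ i → coord i ∘ decode)
                (λ i j r → trans (cong (coord j) (decode-encode _)) (coord-σ i j (decode r)))
                (λ coord≡ → trans (sym (encode-decode _)) (trans (cong encode (coord-injective coord≡)) (encode-decode _)))
                public

  V : Fin D → State → Fin (D * N)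
  V i x = vertex i (encode x)

  Reach-σ : ∀ {i j} x → i ≢ j → Reach G (V i x) (V j (σ i j x))
  Reach-σ {i} {j} x i≢j = step (subst (λ y → adj G (V i x) (V j (σ i j y)) ≡ true) (decode-encode x)
                                      (adj-π (encode x) i≢j))
                               here

  -- Around the triangle of classes 0 → 1 → 2 → 0 the state advances by one step of the
  -- odometer with digits w, a, b (b the fastest).
  τ : State → State
  τ = σ 2F 0F ∘ σ 1F 2F ∘ σ 0F 1F

  Reach-τ : ∀ x → Reach G (V 0F x) (V 0F (τ x))
  Reach-τ x = Reach-trans G (Reach-σ {0F} {1F} x λ ())
             (Reach-trans G (Reach-σ {1F} {2F} (σ 0F 1F x) λ ())
                            (Reach-σ {2F} {0F} (σ 1F 2F (σ 0F 1F x)) λ ()))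

  Reach-τ⁻¹ : ∀ {x y} → τ x ≡ y → Reach G (V 0F y) (V 0F x)
  Reach-τ⁻¹ {x} refl = Reach-sym G (Reach-τ x)

  τ-increment-b : ∀ a (b : Fin m′) w → τ (a , inject₁ b , w) ≡ (a , suc b , w)
  τ-increment-b a b w rewrite isLast-inject₁ b | next-inject₁ b = refl

  τ-carry-to-a : ∀ (a : Fin m′) w → τ (inject₁ a , fromℕ m′ , w) ≡ (suc a , zero , w)
  τ-carry-to-a a w rewrite isLast-fromℕ m′ | isLast-inject₁ a | next-inject₁ a | next-fromℕ m′ = refl

  τ-carry-to-w : ∀ (w : Fin c) → τ (fromℕ m′ , fromℕ m′ , inject₁ w) ≡ (zero , zero , suc w)
  τ-carry-to-w w rewrite isLast-fromℕ m′ | next-inject₁ w | next-fromℕ m′ = refl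

  Reach-b≡0 : ∀ a b w → Reach G (V 0F (a , b , w)) (V 0F (a , zero , w))
  Reach-b≡0 a b w = <-weakInduction (λ b → Reach G (V 0F (a , b , w)) (V 0F (a , zero , w))) here
    (λ b ih → Reach-trans G (Reach-τ⁻¹ (τ-increment-b a b w)) ih) b

  Reach-a≡0 : ∀ a w → Reach G (V 0F (a , zero , w)) (V 0F (zero , zero , w))
  Reach-a≡0 a w = <-weakInduction (λ a → Reach G (V 0F (a , zero , w)) (V 0F (zero , zero , w))) here
    (λ a ih → Reach-trans G (Reach-τ⁻¹ (τ-carry-to-a a w))
               (Reach-trans G (Reach-b≡0 (inject₁ a) (fromℕ m′) w) ih)) a

  Reach-w≡0 : ∀ w → Reach G (V 0F (zero , zero , w)) (V 0F (zero , zero , zero))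
  Reach-w≡0 = <-weakInduction (λ w → Reach G (V 0F (zero , zero , w)) (V 0F (zero , zero , zero))) here
    (λ w ih → Reach-trans G (Reach-τ⁻¹ (τ-carry-to-w w))
               (Reach-trans G (Reach-b≡0 (fromℕ m′) (fromℕ m′) (inject₁ w))
               (Reach-trans G (Reach-a≡0 (fromℕ m′) (inject₁ w)) ih)))

  root : Fin (D * N)
  root = V 0F (zero , zero , zero)

  Reach-root-V0 : ∀ x → Reach G (V 0F x) root
  Reach-root-V0 (a , b , w) = Reach-trans G (Reach-b≡0 a b w) (Reach-trans G (Reach-a≡0 a w) (Reach-w≡0 w))

  Reach-root-V : ∀ i x → Reach G (V i x) root
  Reach-root-V i x with i ≟ 0F
  ... | yes refl = Reach-root-V0 x
  ... | no i≢0   = Reach-trans G (Reach-σ x i≢0) (Reach-root-V0 (σ i 0F x))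

  Reach-root : ∀ u → Reach G u root
  Reach-root u with vertex-surjective u
  ... | i , r , refl = subst (λ u → Reach G u root) (cong (vertex i) (encode-decode r)) (Reach-root-V i (decode r))

  connected : Connected G
  connected u v = Reach-trans G (Reach-root u) (Reach-sym G (Reach-root v))

construction : ∀ Δ → 2 ≤ Δ → ∀ K →
  Σ ℕ λ n → Σ (Graph n) λ G → Σ ℕ λ k →
    K ≤ k × Connected G × MaxDegree G Δ × χNL≡ G k × Δ * k ^ suc Δ ≤ 32 * n * (Δ ∸ 1) ^ suc Δ
construction Δ@(suc (suc s)) 2≤Δ@(s≤s (s≤s z≤n)) K =
  D * N , G , k , K≤k , connected , ((λ u → ≤-reflexive (deg-regular u)) , root , deg-regular root) , χ≡k , bound
  where
  m = suc (K * 2 ^ K)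
  c = pred (m ^ suc s)
  suc-c : suc c ≡ m ^ suc s
  suc-c = suc-pred (m ^ suc s) {{m^n≢0 m (suc s)}}
  open Odometer {s} {K * 2 ^ K} {c} (finToFun ∘ subst Fin suc-c) (subst-injective {P = Fin} suc-c ∘ finToFun-injective)
    using (D; N; G; deg-regular; root; connected; color; color-isNLColoring)
  χ = χNL-exists G (color , color-isNLColoring)
  k = proj₁ χ
  k≤D*m = proj₁ (proj₂ χ)
  χ≡k = proj₂ (proj₂ χ)
  K≤k : K ≤ k
  K≤k = ≮⇒≥ λ k<K → <-irrefl refl (begin-strict
    D * N       ≤⟨ order≤k*2^k G (proj₁ χ≡k) ⟩
    k * 2 ^ k   ≤⟨ *-mono-≤ (<⇒≤ k<K) (^-monoʳ-≤ 2 (<⇒≤ k<K)) ⟩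
    K * 2 ^ K   <⟨ ≤-refl ⟩
    m           ≤⟨ m≤m*n m (m * suc c) ⟩
    N           ≤⟨ m≤n*m N D ⟩
    D * N       ∎)
    where open ≤-Reasoning
  bound : Δ * k ^ suc Δ ≤ 32 * (D * N) * (Δ ∸ 1) ^ suc Δ
  bound = subst (λ W → Δ * k ^ suc Δ ≤ 32 * (D * (m * (m * W))) * (Δ ∸ 1) ^ suc Δ) (sym suc-c)
                (Δ*k^[1+Δ]≤32*[1+Δ]*m^[1+Δ]*[Δ∸1]^[1+Δ] Δ {k} {m} 2≤Δ k≤D*m)

theorem4 : Σ ℕ λ p → Σ ℕ λ q → 1 ≤ p × 1 ≤ q ×
    (∀ (Δ : ℕ) → 2 ≤ Δ → ∀ (K : ℕ) →
      Σ ℕ λ n → Σ (Graph n) λ G → Σ ℕ λ k →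
        K ≤ k × Connected G × MaxDegree G Δ × χNL≡ G k ×
        p * Δ * k ^ (Δ + 1) ≤ q * n * (Δ ∸ 1) ^ (Δ + 1))
theorem4 = 1 , 32 , ≤-refl , s≤s z≤n , λ Δ 2≤Δ K →
  let n , G , k , K≤k , connected , maxDegree , χ≡k , bound = construction Δ 2≤Δ K
      exponent = +-comm 1 Δ
  in n , G , k , K≤k , connected , maxDegree , χ≡k ,
     subst₂ _≤_ (cong₂ (λ a e → a * k ^ e) (sym (*-identityˡ Δ)) exponent)
                (cong (λ e → 32 * n * (Δ ∸ 1) ^ e) exponent)
                bound
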